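{- Let $p$ be a prime, $k$ an integer with $1<k<p$, $A\subset\mathbb{F}_p$, and $\mathbb{F}$ a field with $\operatorname{char}\mathbb{F}\nmid p$. Let $y=\prod_{j=1}^k x_j$ and let $P\subset G$ be the cyclic subgroup generated by $y$. Then the $\mathbb{F}$-linear map $B:\mathbb{F}[P]\otimes_{\mathbb{F}}\mathcal{H}(A)\to\mathcal{R}$ given by $B(u\otimes s)=(u\,\rho_a(s))_{a\in A}$ is an isomorphism.
   Context: $\mathbb{F}_p=\{0,\ldots,p-1\}$. Let $\mathcal{F}(\mathbb{F}_p^k,\mathbb{F})$ be the space of functions $\mathbb{F}_p^k\to\mathbb{F}$. A function $\phi$ is skew-symmetric if $\phi(\gamma_{\sigma^{ -1}(1)},\ldots,\gamma_{\sigma^{ -1}(k)})=\operatorname{sgn}(\sigma)\phi(\gamma_1,\ldots,\gamma_k)$ for all $\gamma\in\mathbb{F}_p^k$ and $\sigma\in S_k$, and, if $\operatorname{char}\mathbb{F}=2$, additionally $\phi(\gamma)=0$ whenever $\gamma_i=\gamma_j$ for some $i\ne j$. For $d\in\mathbb{F}_p$ let $W_d=\{\alpha\in\mathbb{F}_p^k:\sum_i\alpha_i=d\}$. Let $C_p$ be the multiplicative cyclic group of order $p$, $G=C_p^k$, with a fixed generating set $\{x_1,\ldots,x_k\}$; for $\gamma\in\mathbb{F}_p^k$ write $x^\gamma=\prod_j x_j^{\gamma_j}$. Let $q:\mathcal{F}(\mathbb{F}_p^k,\mathbb{F})\to\mathbb{F}[G]$ be $q(\phi)=\sum_\gamma\phi(\gamma)x^\gamma$.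 Let $\mathbb{F}[G]_d=q(\{\phi:\operatorname{supp}\phi\subset W_d\})$, so $\mathbb{F}[G]=\bigoplus_{d}\mathbb{F}[G]_d$, and $\rho_d$ the projection onto $\mathbb{F}[G]_d$. Let $\mathcal{S}=q(\{\text{skew-symmetric }\phi\})$ and $\mathcal{S}_d=\mathcal{S}\cap\mathbb{F}[G]_d$. Define $\mathcal{H}(A)=\{s\in\bigoplus_{a\in A}\mathcal{S}_a:\ \sum_{a\in A}x_i^{ -a}\rho_a(s)=0\text{ for all }1\le i\le k\}$ and $\mathcal{R}=\{(r_a)_{a\in A}\in\mathcal{S}^A:\ \sum_{a\in A}x_i^{ -a}r_a=0\text{ for all }1\le i\le k\}$. $\mathbb{F}[P]\subset\mathbb{F}[G]$ is the group algebra of $P$. -}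

module Defs where

open import Level using (Level; _⊔_; suc)
open import Algebra.Bundles using (CommutativeRing)
open import Data.Nat as ℕ using (ℕ; zero; NonZero; _%_; _∸_)
import Data.Nat.Properties as ℕP
open import Data.Nat.DivMod using (m%n<n)
open import Data.Bool using (Bool; true; false; if_then_else_; _xor_)
open import Data.Fin as Fin using (Fin; toℕ; fromℕ<; _<?_)
open import Data.Fin.Subset using (Subset; _∈_)
open import Data.Fin.Subset.Properties using (_∈?_)
open import Data.Fin.Permutation using (Permutation′; _⟨$⟩ʳ_; _⟨$⟩ˡ_)
open import Data.Vec as Vec using (Vec; []; _∷_; lookup; tabulate; replicate; zipWith)
import Data.Vec.Properties as VecP
open import Data.List as List using (List; []; _∷_; concatMap; foldr; allFin)
open import Data.Product using (Σ; ∃; _×_; _,_; proj₁)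
open import Relation.Nullary using (¬_; Dec; yes; no; does)
open import Relation.Binary.PropositionalEquality using (_≡_; _≢_)

record Field (c ℓ : Level) : Set (suc (c ⊔ ℓ)) where
  field
    commutativeRing : CommutativeRing c ℓ
  open CommutativeRing commutativeRing public
  field
    1≉0     : ¬ (1# ≈ 0#)
    inverse : ∀ x → ¬ (x ≈ 0#) → ∃ λ y → (x * y) ≈ 1#

_·1 : ∀ {c ℓ} {F : Field c ℓ} → ℕ → Field.Carrier F
_·1 {F = F} zero    = Field.0# F
_·1 {F = F} (ℕ.suc n) = Field._+_ F (Field.1# F) (_·1 {F = F} n)

CharNotDvd : ∀ {c ℓ} (F : Field c ℓ) → ℕ → Set ℓ
CharNotDvd F p = ¬ (Field._≈_ F (_·1 {F = F} p) (Field.0# F))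

CharTwo : ∀ {c ℓ} (F : Field c ℓ) → Set ℓ
CharTwo F = Field._≈_ F (Field._+_ F (Field.1# F) (Field.1# F)) (Field.0# F)

oddInversions : ∀ {k} → Permutation′ k → Bool
oddInversions {k} σ =
  foldr _xor_ false
    (concatMap (λ i → List.map (λ j → inv i j) (allFin k)) (allFin k))
  where
  inv : Fin k → Fin k → Bool
  inv i j with i <? j | (σ ⟨$⟩ʳ j) <? (σ ⟨$⟩ʳ i)
  ... | yes _ | yes _ = true
  ... | _     | _     = false

module Setup {c ℓ} (F : Field c ℓ) (p : ℕ) {{_ : NonZero p}} (k : ℕ) (A : Subset p) where
  open Field F

  Fp : Set
  Fp = Fin p

  _+ₚ_ : Fp → Fp → Fp
  a +ₚ b = fromℕ< (m%n<n (toℕ a ℕ.+ toℕ b) p)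

  -ₚ_ : Fp → Fp
  -ₚ a = fromℕ< (m%n<n (p ∸ toℕ a) p)

  0ₚ : Fp
  0ₚ = fromℕ< (m%n<n 0 p)

  ⟦_⟧ₚ : ℕ → Fp
  ⟦ j ⟧ₚ = fromℕ< (m%n<n j p)

  -- exponent vectors γ ∈ 𝔽_p^k (equivalently, elements x^γ of G = C_p^k)
  Exp : Set
  Exp = Vec Fp k

  _-ᵥ_ : Exp → Exp → Exp
  γ -ᵥ α = zipWith (λ a b → a +ₚ (-ₚ b)) γ α

  coordSum : ∀ {n} → Vec Fp n → Fp
  coordSum []       = 0ₚ
  coordSum (a ∷ γ)  = a +ₚ coordSum γ

  allVecs : (n : ℕ) → List (Vec Fp n)
  allVecs zero      = [] ∷ []
  allVecs (ℕ.suc n) = concatMap (λ a → List.map (a ∷_) (allVecs n)) (allFin p)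

  sumList : ∀ {X : Set} → List X → (X → Carrier) → Carrier
  sumList xs f = foldr (λ x acc → f x + acc) 0# xs

  -- group algebra 𝔽[G]: an element is identified with its coefficient
  -- function φ : 𝔽_p^k → 𝔽 (i.e. q(φ) = Σ φ(γ) x^γ)
  FG : Set c
  FG = Exp → Carrier

  _≈G_ : FG → FG → Set ℓ
  f ≈G g = ∀ γ → f γ ≈ g γ

  0G : FG
  0G _ = 0#

  _+G_ : FG → FG → FG
  (f +G g) γ = f γ + g γ

  _⋆_ : FG → FG → FG
  (f ⋆ g) γ = sumList (allVecs k) (λ α → f α * g (γ -ᵥ α))

  x^ : Exp → FG
  x^ β γ with VecP.≡-dec Fin._≟_ γ β
  ... | yes _ = 1#
  ... | no  _ = 0#

  x[_]^ : Fin k → Fp → FG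
  x[ i ]^ e = x^ (tabulate λ j → if does (Fin._≟_ j i) then e else 0ₚ)

  -- y = x_1 ⋯ x_k, so y^j = x^(j,…,j)
  y^ : ℕ → FG
  y^ j = x^ (replicate k ⟦ j ⟧ₚ)

  ρ : Fp → FG → FG
  ρ d s γ with Fin._≟_ (coordSum γ) d
  ... | yes _ = s γ
  ... | no  _ = 0#

  sgn : Permutation′ k → Carrier
  sgn σ = if oddInversions σ then - 1# else 1#

  IsSkew : FG → Set ℓ
  IsSkew φ =
    (∀ (γ : Exp) (σ : Permutation′ k) →
        φ (tabulate λ i → lookup γ (σ ⟨$⟩ˡ i)) ≈ (sgn σ * φ γ))
    × (CharTwo F → ∀ (γ : Exp) (i j : Fin k) → i ≢ j →
        lookup γ i ≡ lookup γ j → φ γ ≈ 0#)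

  sumA : (Fp → FG) → FG
  sumA f γ = sumList (allFin p) (λ a → term a)
    where
    term : Fp → Carrier
    term a with a ∈? A
    ... | yes _ = f a γ
    ... | no  _ = 0#

  -- s ∈ ⊕_{a∈A} 𝒮_a : s = Σ_{a∈A} ρ_a(s) with each ρ_a(s) ∈ 𝒮
  InDirectSum : FG → Set ℓ
  InDirectSum s =
    (∀ a → a ∈ A → IsSkew (ρ a s))
    × (∀ d → ¬ (d ∈ A) → ρ d s ≈G 0G)

  InH : FG → Set ℓ
  InH s = InDirectSum s
    × (∀ (i : Fin k) → sumA (λ a → x[ i ]^ (-ₚ a) ⋆ ρ a s) ≈G 0G)

  H : Set (c ⊔ ℓ)
  H = Σ FG InH

  Tuple : Set c
  Tuple = (a : Fp) → a ∈ A → FG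

  _≈T_ : Tuple → Tuple → Set ℓ
  r ≈T r' = ∀ a (a∈A : a ∈ A) → r a a∈A ≈G r' a a∈A

  InR : Tuple → Set ℓ
  InR r = (∀ a (a∈A : a ∈ A) → IsSkew (r a a∈A))
    × (∀ (i : Fin k) → sumA' i ≈G 0G)
    where
    sumA' : Fin k → FG
    sumA' i γ = sumList (allFin p) term
      where
      term : Fp → Carrier
      term a with a ∈? A
      ... | yes a∈A = (x[ i ]^ (-ₚ a) ⋆ r a a∈A) γ
      ... | no  _   = 0#

  -- 𝔽[P] ⊗ ℋ(A): since 𝔽[P] has basis y^0,…,y^(p-1), an element is
  -- uniquely Σ_j y^j ⊗ s_j, encoded as the family (s_j)_{j<p}.
  Tensor : Set (c ⊔ ℓ)
  Tensor = Fin p → H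

  _≈⊗_ : Tensor → Tensor → Set ℓ
  t ≈⊗ t' = ∀ j → proj₁ (t j) ≈G proj₁ (t' j)

  sumFin : (Fin p → FG) → FG
  sumFin f γ = sumList (allFin p) (λ j → f j γ)

  B : Tensor → Tuple
  B t a _ = sumFin (λ j → y^ (toℕ j) ⋆ ρ a (proj₁ (t j)))

  -- B is a well-defined (ℱ-linear by construction) map into ℛ which is bijective
  BIsIsomorphism : Set (c ⊔ ℓ)
  BIsIsomorphism =
    (∀ t → InR (B t))
    × (∀ t t' → B t ≈T B t' → t ≈⊗ t')
    × (∀ r → InR r → ∃ λ t → B t ≈T r)

-- Write 𝟙ⱼ = diag j = (j,…,j) for the exponent of yʲ. Its coordinate sum is k·j and k is
-- invertible mod p, so for every exponent γ and level a exactly one j puts γ − 𝟙ⱼ on the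
-- level W_a, and B(Σⱼ yʲ ⊗ sⱼ)_a(γ) = sⱼ(γ − 𝟙ⱼ) for that j: B merely redistributes
-- coefficients, and sⱼ(δ) = r_{Σδ}(δ + 𝟙ⱼ) inverts it. Permuting coordinates fixes 𝟙ⱼ and
-- the levels, so skew-symmetry is preserved both ways. Translation by 𝟙ⱼ commutes with
-- multiplication by x_i^{−a}, which carries the relations Σ_a x_i^{−a} r_a = 0 from the sⱼ
-- to r; conversely the relation for sⱼ at δ only involves the levels Σδ + a = a, i.e.
-- Σδ = 0, where it is the relation for r at δ + 𝟙ⱼ.

module Submission where

open import Defs
open import Algebra.Bundles using (AbelianGroup; CommutativeMonoid)
open import Algebra.Consequences.Propositional using (comm∧idˡ⇒id; comm∧invˡ⇒inv)
import Algebra.Properties.AbelianGroup as AbelianGroupProperties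
import Algebra.Properties.CommutativeMonoid.Mult as MultProperties
import Algebra.Properties.CommutativeSemigroup as CommutativeSemigroupProperties
open import Data.Bool using (if_then_else_)
open import Data.Fin as Fin using (Fin; toℕ; fromℕ<; punchOut)
import Data.Fin.Properties as FinP
open import Data.Fin.Permutation using (Permutation′; _⟨$⟩ˡ_; flip)
open import Data.Fin.Subset using (Subset; _∈_)
open import Data.Fin.Subset.Properties using (_∈?_)
open import Data.List as List using (List; []; _∷_; _++_; allFin; concatMap)
import Data.List.Properties as ListP
open import Data.Nat as ℕ using (ℕ; zero; suc; NonZero; _∸_; _%_; _<_; z<s)
open import Data.Nat.Divisibility using (_∣_; m%n≡0⇒n∣m; >⇒∤)
open import Data.Nat.DivMod using (m%n<n; %-distribˡ-+; n%n≡0; m<n⇒m%n≡m)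
import Data.Nat.Properties as ℕP
import Relation.Binary.Reasoning.Setoid
open import Data.Nat.Primality using (Prime; euclidsLemma)
open import Data.Product using (Σ; ∃; _,_; proj₁; proj₂)
open import Data.Sum using (inj₁; inj₂)
open import Data.Vec using (Vec; []; _∷_; lookup; tabulate; replicate; zipWith)
import Data.Vec.Properties as VecP
open import Data.Vec.Properties.WithK using ([]=-irrelevant)
open import Data.Vec.Functional using (removeAt)
open import Function using (_∘_; id)
open import Function.Definitions using (Injective)
open import Level using (0ℓ)
open import Relation.Binary.PropositionalEquality
  using (_≡_; _≢_; refl; sym; trans; cong; cong₂; module ≡-Reasoning)
open import Relation.Binary.PropositionalEquality.Algebra using (isMagma)
open import Relation.Nullary using (¬_; Dec; yes; no; does; contradiction)
open import Relation.Nullary.Decidable using (dec-true; dec-false)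

injective⇒onto : ∀ {n} {f : Fin n → Fin n} → Injective _≡_ _≡_ f → ∀ y → ∃ λ x → f x ≡ y
injective⇒onto {suc n} {f} f-inj y with FinP.any? (λ x → f x FinP.≟ y)
... | yes hit  = hit
... | no  miss = contradiction (FinP.injective⇒≤ g-inj) ℕP.1+n≰n
  where
  g : Fin (suc n) → Fin n
  g x = punchOut {i = y} λ y≡fx → miss (x , sym y≡fx)
  g-inj : Injective _≡_ _≡_ g
  g-inj gx≡gx′ = f-inj (FinP.punchOut-injective {i = y} _ _ gx≡gx′)

-- The operations _+ₚ_, -ₚ_, 0ₚ, ⟦_⟧ₚ of Setup, free of its unrelated parameters: they
-- agree definitionally, so the lemmas below apply to Setup's operations.
module Modular (p : ℕ) {{_ : NonZero p}} where

  ⟦_⟧ : ℕ → Fin p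
  ⟦ n ⟧ = fromℕ< (m%n<n n p)

  infixl 6 _+_
  infix  8 -_

  _+_ : Fin p → Fin p → Fin p
  a + b = ⟦ toℕ a ℕ.+ toℕ b ⟧

  -_ : Fin p → Fin p
  - a = ⟦ p ∸ toℕ a ⟧

  0# : Fin p
  0# = ⟦ 0 ⟧

  ⟦⟧-cong : ∀ {m n} → m % p ≡ n % p → ⟦ m ⟧ ≡ ⟦ n ⟧
  ⟦⟧-cong {m} {n} eq = FinP.fromℕ<-cong (m % p) (n % p) eq (m%n<n m p) (m%n<n n p)

  ⟦toℕ⟧ : ∀ a → ⟦ toℕ a ⟧ ≡ a
  ⟦toℕ⟧ a = FinP.toℕ-injective
    (trans (FinP.toℕ-fromℕ< (m%n<n (toℕ a) p)) (m<n⇒m%n≡m (FinP.toℕ<n a)))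

  ⟦⟧-homo-+ : ∀ m n → ⟦ m ⟧ + ⟦ n ⟧ ≡ ⟦ m ℕ.+ n ⟧
  ⟦⟧-homo-+ m n = trans
    (cong₂ (λ x y → ⟦ x ℕ.+ y ⟧) (FinP.toℕ-fromℕ< (m%n<n m p)) (FinP.toℕ-fromℕ< (m%n<n n p)))
    (⟦⟧-cong (sym (%-distribˡ-+ m n p)))

  0%p≡0 : 0 % p ≡ 0
  0%p≡0 = m<n⇒m%n≡m (ℕ.>-nonZero⁻¹ p)

  toℕ-0# : toℕ 0# ≡ 0
  toℕ-0# = trans (FinP.toℕ-fromℕ< (m%n<n 0 p)) 0%p≡0

  +-assoc : ∀ a b c → (a + b) + c ≡ a + (b + c)
  +-assoc a b c = begin
    ⟦ a′ ℕ.+ b′ ⟧ + c        ≡⟨ cong (⟦ a′ ℕ.+ b′ ⟧ +_) (⟦toℕ⟧ c) ⟨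
    ⟦ a′ ℕ.+ b′ ⟧ + ⟦ c′ ⟧   ≡⟨ ⟦⟧-homo-+ (a′ ℕ.+ b′) c′ ⟩
    ⟦ a′ ℕ.+ b′ ℕ.+ c′ ⟧     ≡⟨ cong ⟦_⟧ (ℕP.+-assoc a′ b′ c′) ⟩
    ⟦ a′ ℕ.+ (b′ ℕ.+ c′) ⟧   ≡⟨ ⟦⟧-homo-+ a′ (b′ ℕ.+ c′) ⟨
    ⟦ a′ ⟧ + (b + c)         ≡⟨ cong (_+ (b + c)) (⟦toℕ⟧ a) ⟩
    a + (b + c)              ∎
    where
    open ≡-Reasoning
    a′ = toℕ a
    b′ = toℕ b
    c′ = toℕ c

  +-comm : ∀ a b → a + b ≡ b + a
  +-comm a b = cong ⟦_⟧ (ℕP.+-comm (toℕ a) (toℕ b))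

  +-identityˡ : ∀ a → 0# + a ≡ a
  +-identityˡ a = begin
    0# + a          ≡⟨ cong (0# +_) (⟦toℕ⟧ a) ⟨
    0# + ⟦ toℕ a ⟧  ≡⟨ ⟦⟧-homo-+ 0 (toℕ a) ⟩
    ⟦ toℕ a ⟧       ≡⟨ ⟦toℕ⟧ a ⟩
    a               ∎
    where open ≡-Reasoning

  -‿inverseˡ : ∀ a → - a + a ≡ 0#
  -‿inverseˡ a = begin
    - a + a                      ≡⟨ cong (- a +_) (⟦toℕ⟧ a) ⟨
    - a + ⟦ toℕ a ⟧              ≡⟨ ⟦⟧-homo-+ (p ∸ toℕ a) (toℕ a) ⟩
    ⟦ p ∸ toℕ a ℕ.+ toℕ a ⟧      ≡⟨ cong ⟦_⟧ (ℕP.m∸n+n≡m (ℕP.<⇒≤ (FinP.toℕ<n a))) ⟩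
    ⟦ p ⟧                        ≡⟨ ⟦⟧-cong (trans (n%n≡0 p) (sym 0%p≡0)) ⟩
    0#                           ∎
    where open ≡-Reasoning

  +-abelianGroup : AbelianGroup 0ℓ 0ℓ
  +-abelianGroup = record
    { _∙_ = _+_
    ; ε = 0#
    ; _⁻¹ = -_
    ; isAbelianGroup = record
      { isGroup = record
        { isMonoid = record
          { isSemigroup = record { isMagma = isMagma _+_ ; assoc = +-assoc }
          ; identity = comm∧idˡ⇒id +-comm +-identityˡ
          }
        ; inverse = comm∧invˡ⇒inv +-comm -‿inverseˡ
        ; ⁻¹-cong = cong -_
        }
      ; comm = +-comm
      }
    }

  open AbelianGroup +-abelianGroup public using (commutativeMonoid)
  open AbelianGroup +-abelianGroup using (inverseʳ)
  open AbelianGroupProperties +-abelianGroup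
  open import Algebra.Definitions.RawMonoid (AbelianGroup.rawMonoid +-abelianGroup) public using (_×_)
  open MultProperties commutativeMonoid using (×-distrib-+; ×-idem)

  ×-⟦⟧ : ∀ n a → n × a ≡ ⟦ n ℕ.* toℕ a ⟧
  ×-⟦⟧ zero    a = refl
  ×-⟦⟧ (suc n) a = begin
    a + n × a                  ≡⟨ cong (_+ n × a) (⟦toℕ⟧ a) ⟨
    ⟦ toℕ a ⟧ + n × a          ≡⟨ cong (⟦ toℕ a ⟧ +_) (×-⟦⟧ n a) ⟩
    ⟦ toℕ a ⟧ + ⟦ n ℕ.* toℕ a ⟧ ≡⟨ ⟦⟧-homo-+ (toℕ a) (n ℕ.* toℕ a) ⟩
    ⟦ suc n ℕ.* toℕ a ⟧        ∎
    where open ≡-Reasoning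

  ×≡0#⇒∣ : ∀ n a → n × a ≡ 0# → p ∣ n ℕ.* toℕ a
  ×≡0#⇒∣ n a n×a≡0 = m%n≡0⇒n∣m _ p (begin
    n ℕ.* toℕ a % p       ≡⟨ FinP.toℕ-fromℕ< (m%n<n (n ℕ.* toℕ a) p) ⟨
    toℕ ⟦ n ℕ.* toℕ a ⟧   ≡⟨ cong toℕ (trans (sym (×-⟦⟧ n a)) n×a≡0) ⟩
    toℕ 0#                ≡⟨ toℕ-0# ⟩
    0                     ∎)
    where open ≡-Reasoning

  module _ (p-prime : Prime p) {k} (0<k : 0 < k) (k<p : k < p) where

    private
      below-p : ∀ {n} → p ∣ n → n < p → n ≡ 0
      below-p {zero}  _   _   = refl
      below-p {suc n} p∣n n<p = contradiction p∣n (>⇒∤ n<p)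

    ×-zero : ∀ {a} → k × a ≡ 0# → a ≡ 0#
    ×-zero {a} k×a≡0 with euclidsLemma k (toℕ a) p-prime (×≡0#⇒∣ k a k×a≡0)
    ... | inj₁ p∣k = contradiction (below-p p∣k k<p) (ℕP.>⇒≢ 0<k)
    ... | inj₂ p∣a = FinP.toℕ-injective (trans (below-p p∣a (FinP.toℕ<n a)) (sym toℕ-0#))

    private
      instance
        k≢0 : NonZero k
        k≢0 = ℕ.>-nonZero 0<k

      ×-homo-⁻¹ : ∀ a → k × - a ≡ - (k × a)
      ×-homo-⁻¹ a = inverseˡ-unique (k × - a) (k × a) (begin
        k × - a + k × a   ≡⟨ ×-distrib-+ (- a) a k ⟨
        k × (- a + a)     ≡⟨ cong (k ×_) (-‿inverseˡ a) ⟩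
        k × 0#            ≡⟨ ×-idem (+-identityˡ 0#) k ⟩
        0#                ∎)
        where open ≡-Reasoning

    ×-injective : Injective _≡_ _≡_ (k ×_)
    ×-injective {a} {b} k×a≡k×b = x∙y⁻¹≈ε⇒x≈y a b (×-zero (begin
      k × (a + - b)       ≡⟨ ×-distrib-+ a (- b) k ⟩
      k × a + k × - b     ≡⟨ cong (k × a +_) (×-homo-⁻¹ b) ⟩
      k × a + - (k × b)   ≡⟨ cong (λ x → k × a + - x) k×a≡k×b ⟨
      k × a + - (k × a)   ≡⟨ inverseʳ (k × a) ⟩
      0#                  ∎))
      where open ≡-Reasoning

module Summation {a ℓ} (M : CommutativeMonoid a ℓ) where

  open CommutativeMonoid M using (Carrier; _≈_; _∙_; ε; ∙-congˡ; identityʳ; setoid)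
  open import Algebra.Properties.CommutativeMonoid.Sum M public
  open Relation.Binary.Reasoning.Setoid setoid

  sum-zero : ∀ {n} {f : Fin n → Carrier} → (∀ i → f i ≈ ε) → sum f ≈ ε
  sum-zero {n} {f} f≈ε = begin
    sum f                      ≈⟨ sum-cong-≋ {n} f≈ε ⟩
    sum {n} (λ _ → ε)          ≈⟨ sum-replicate-zero n ⟩
    ε                          ∎

  sum-δ : ∀ {n} {f : Fin n → Carrier} i → (∀ j → j ≢ i → f j ≈ ε) → sum f ≈ f i
  sum-δ {suc _} {f} i f≈ε = begin
    sum f                     ≈⟨ sum-remove {i = i} f ⟩
    f i ∙ sum (removeAt f i)  ≈⟨ ∙-congˡ (sum-zero λ j → f≈ε _ (FinP.punchInᵢ≢i i j)) ⟩
    f i ∙ ε                   ≈⟨ identityʳ (f i) ⟩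
    f i                       ∎

module _ {a b} {A : Set a} {B : Set b} {f g : A → B → A} where

  zipWith-cancel : (∀ x y → f (g x y) y ≡ x) →
                   ∀ {n} (u : Vec A n) (w : Vec B n) → zipWith f (zipWith g u w) w ≡ u
  zipWith-cancel cancel []      []      = refl
  zipWith-cancel cancel (x ∷ u) (y ∷ w) = cong₂ _∷_ (cancel x y) (zipWith-cancel cancel u w)

  zipWith-exchange : (∀ x y z → f (g x y) z ≡ g (f x z) y) →
                     ∀ {n} (u : Vec A n) (v w : Vec B n) →
                     zipWith f (zipWith g u v) w ≡ zipWith g (zipWith f u w) v
  zipWith-exchange exch []      []      []      = refl
  zipWith-exchange exch (x ∷ u) (y ∷ v) (z ∷ w) = cong₂ _∷_ (exch x y z) (zipWith-exchange exch u v w)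

module _ {a} {A : Set a} {n : ℕ} where

  lookup-ext : {u v : Vec A n} → (∀ i → lookup u i ≡ lookup v i) → u ≡ v
  lookup-ext {u} {v} u≗v = trans (sym (VecP.tabulate∘lookup u))
                                 (trans (VecP.tabulate-cong u≗v) (VecP.tabulate∘lookup v))

  permute : Permutation′ n → Vec A n → Vec A n
  permute σ γ = tabulate λ i → lookup γ (σ ⟨$⟩ˡ i)

  lookup-permute : ∀ σ (γ : Vec A n) i → lookup (permute σ γ) i ≡ lookup γ (σ ⟨$⟩ˡ i)
  lookup-permute σ γ = VecP.lookup∘tabulate _

  permute-zipWith : ∀ (_⊕_ : A → A → A) σ (u v : Vec A n) →
                    permute σ (zipWith _⊕_ u v) ≡ zipWith _⊕_ (permute σ u) (permute σ v)
  permute-zipWith _⊕_ σ u v = lookup-ext λ i → begin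
    lookup (permute σ (zipWith _⊕_ u v)) i        ≡⟨ lookup-permute σ (zipWith _⊕_ u v) i ⟩
    lookup (zipWith _⊕_ u v) (σ ⟨$⟩ˡ i)           ≡⟨ VecP.lookup-zipWith _⊕_ _ u v ⟩
    lookup u (σ ⟨$⟩ˡ i) ⊕ lookup v (σ ⟨$⟩ˡ i)     ≡⟨ cong₂ _⊕_ (lookup-permute σ u i) (lookup-permute σ v i) ⟨
    lookup (permute σ u) i ⊕ lookup (permute σ v) i  ≡⟨ VecP.lookup-zipWith _⊕_ i (permute σ u) (permute σ v) ⟨
    lookup (zipWith _⊕_ (permute σ u) (permute σ v)) i ∎
    where open ≡-Reasoning

  permute-replicate : ∀ σ (x : A) → permute σ (replicate n x) ≡ replicate n x
  permute-replicate σ x = lookup-ext λ i →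
    trans (lookup-permute σ (replicate n x) i)
          (trans (VecP.lookup-replicate (σ ⟨$⟩ˡ i) x) (sym (VecP.lookup-replicate i x)))

module Isomorphism {c ℓ} (F : Field c ℓ) (p : ℕ) {{_ : NonZero p}} (k : ℕ) (A : Subset p)
                   (k×-injective : Injective _≡_ _≡_ (Modular._×_ p k)) where

  open Setup F p k A
  open Field F hiding (zero)
    renaming (refl to ≈-refl; sym to ≈-sym; trans to ≈-trans; reflexive to ≈-reflexive)
  open Summation +-commutativeMonoid
  open import Algebra.Properties.Semiring.Sum semiring using (*-distribˡ-sum)
  module ℤₚ = Modular p
  module Σₚ = Summation ℤₚ.commutativeMonoid
  module ≈-Reasoning = Relation.Binary.Reasoning.Setoid setoid
  open ℤₚ using () renaming (_×_ to _×ₚ_)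
  open AbelianGroupProperties ℤₚ.+-abelianGroup
  open CommutativeSemigroupProperties (AbelianGroup.commutativeSemigroup ℤₚ.+-abelianGroup)
    using (xy∙z≈xz∙y; interchange)

  sumList-tabulate : ∀ {X : Set} {n} (g : Fin n → X) (f : X → Carrier) →
                     sumList (List.tabulate g) f ≡ sum (f ∘ g)
  sumList-tabulate {n = zero}  g f = refl
  sumList-tabulate {n = suc n} g f = cong (f (g Fin.zero) +_) (sumList-tabulate (g ∘ Fin.suc) f)

  sumList-allFin : ∀ {n} (f : Fin n → Carrier) → sumList (allFin n) f ≡ sum f
  sumList-allFin = sumList-tabulate id

  sumList-++ : ∀ {X : Set} (xs ys : List X) (f : X → Carrier) →
               sumList (xs ++ ys) f ≈ sumList xs f + sumList ys f
  sumList-++ []       ys f = ≈-sym (+-identityˡ _)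
  sumList-++ (x ∷ xs) ys f = ≈-trans (+-congˡ (sumList-++ xs ys f)) (≈-sym (+-assoc (f x) _ _))

  sumList-concatMap : ∀ {X Y : Set} (h : X → List Y) (xs : List X) (f : Y → Carrier) →
                      sumList (concatMap h xs) f ≈ sumList xs (λ x → sumList (h x) f)
  sumList-concatMap h []       f = ≈-refl
  sumList-concatMap h (x ∷ xs) f =
    ≈-trans (sumList-++ (h x) (concatMap h xs) f) (+-congˡ (sumList-concatMap h xs f))

  sumList-allVecs-δ : ∀ n {f : Vec Fp n → Carrier} β → (∀ α → α ≢ β → f α ≈ 0#) →
                      sumList (allVecs n) f ≈ f β
  sumList-allVecs-δ zero    []      _   = +-identityʳ _
  sumList-allVecs-δ (suc n) {f} (b ∷ β) f≈0 = begin
    sumList (concatMap (λ a → List.map (a ∷_) (allVecs n)) (allFin p)) f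
      ≈⟨ sumList-concatMap _ (allFin p) f ⟩
    sumList (allFin p) (λ a → sumList (List.map (a ∷_) (allVecs n)) f)
      ≡⟨ sumList-allFin {p} _ ⟩
    sum (λ (a : Fp) → sumList (List.map (a ∷_) (allVecs n)) f)
      ≈⟨ sum-cong-≋ (λ a → ≈-reflexive (ListP.foldr-map _ (a ∷_) 0# (allVecs n))) ⟩
    sum (λ (a : Fp) → sumList (allVecs n) (λ α → f (a ∷ α)))
      ≈⟨ sum-cong-≋ (λ a → sumList-allVecs-δ n β λ α α≢β → f≈0 (a ∷ α) (α≢β ∘ VecP.∷-injectiveʳ)) ⟩
    sum (λ (a : Fp) → f (a ∷ β))
      ≈⟨ sum-δ b (λ a a≢b → f≈0 (a ∷ β) (a≢b ∘ VecP.∷-injectiveˡ)) ⟩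
    f (b ∷ β) ∎
    where open ≈-Reasoning

  when : ∀ {P : Set} → Dec P → (P → Carrier) → Carrier
  when (yes q) g = g q
  when (no _)  _ = 0#

  when-cong : ∀ {P : Set} (d : Dec P) {g h : P → Carrier} → (∀ q → g q ≈ h q) → when d g ≈ when d h
  when-cong (yes q) g≈h = g≈h q
  when-cong (no _)  _   = ≈-refl

  when-zero : ∀ {P : Set} (d : Dec P) {g : P → Carrier} → (∀ q → g q ≈ 0#) → when d g ≈ 0#
  when-zero (yes q) g≈0 = g≈0 q
  when-zero (no _)  _   = ≈-refl

  when-sum : ∀ {P : Set} {n} (d : Dec P) (g : P → Fin n → Carrier) →
             when d (λ q → sum (g q)) ≈ sum (λ j → when d (λ q → g q j))
  when-sum (yes q) g = ≈-refl
  when-sum {n = n} (no _) g = ≈-sym (sum-zero {n} λ _ → ≈-refl)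

  ∑∈A : ((a : Fp) → a ∈ A → Carrier) → Carrier
  ∑∈A g = sum λ a → when (a ∈? A) (g a)

  ∑∈A-cong : ∀ {g h : (a : Fp) → a ∈ A → Carrier} → (∀ a q → g a q ≈ h a q) → ∑∈A g ≈ ∑∈A h
  ∑∈A-cong g≈h = sum-cong-≋ λ a → when-cong (a ∈? A) (g≈h a)

  ∑∈A-zero : ∀ {g : (a : Fp) → a ∈ A → Carrier} → (∀ a q → g a q ≈ 0#) → ∑∈A g ≈ 0#
  ∑∈A-zero g≈0 = sum-zero λ a → when-zero (a ∈? A) (g≈0 a)

  ∑∈A-sum : ∀ {n} (g : (a : Fp) → a ∈ A → Fin n → Carrier) →
            ∑∈A (λ a q → sum (g a q)) ≈ sum (λ j → ∑∈A (λ a q → g a q j))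
  ∑∈A-sum g = ≈-trans (sum-cong-≋ λ a → when-sum (a ∈? A) (g a))
                      (∑-comm λ a j → when (a ∈? A) (λ q → g a q j))

  -- sumA and InR sum over A with summands defined by with-abstraction under a binder;
  -- these auxiliary functions cannot be named, so the summands are read off by unification.
  summand : ∀ {t : Fp → Carrier} (s : Carrier) → s ≡ sumList (allFin p) t → Fp → Carrier
  summand {t} _ _ = t

  relationSum : ∀ {X : Set ℓ} {S : Fin k → Exp → Carrier} (r : Tuple) →
                InR r ≡ Σ X (λ _ → ∀ i γ → S i γ ≈ 0#) → Fin k → Exp → Carrier
  relationSum {S = S} _ _ = S

  sumA≈∑∈A : ∀ f γ → sumA f γ ≈ ∑∈A (λ a _ → f a γ)
  sumA≈∑∈A f γ = ≈-trans (≈-reflexive (sumList-allFin {p} _)) (sum-cong-≋ summand≈)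
    where
    summand≈ : ∀ a → summand (sumA f γ) refl a ≈ when (a ∈? A) (λ _ → f a γ)
    summand≈ a with a ∈? A
    ... | yes _ = ≈-refl
    ... | no  _ = ≈-refl

  relationSum≈∑∈A : ∀ r i γ → relationSum r refl i γ ≈ ∑∈A (λ a q → (x[ i ]^ (-ₚ a) ⋆ r a q) γ)
  relationSum≈∑∈A r i γ = ≈-trans (≈-reflexive (sumList-allFin {p} _)) (sum-cong-≋ summand≈)
    where
    summand≈ : ∀ a → summand (relationSum r refl i γ) refl a ≈
                     when (a ∈? A) (λ q → (x[ i ]^ (-ₚ a) ⋆ r a q) γ)
    summand≈ a with a ∈? A
    ... | yes _ = ≈-refl
    ... | no  _ = ≈-refl

  InR-intro : ∀ {r} → (∀ a q → IsSkew (r a q)) →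
              (∀ i γ → ∑∈A (λ a q → (x[ i ]^ (-ₚ a) ⋆ r a q) γ) ≈ 0#) → InR r
  InR-intro {r} skew rel = skew , λ i γ → ≈-trans (relationSum≈∑∈A r i γ) (rel i γ)

  InR-relation : ∀ {r} → InR r → ∀ i γ → ∑∈A (λ a q → (x[ i ]^ (-ₚ a) ⋆ r a q) γ) ≈ 0#
  InR-relation {r} (_ , rel) i γ = ≈-trans (≈-sym (relationSum≈∑∈A r i γ)) (rel i γ)

  x^-at : ∀ β → x^ β β ≈ 1#
  x^-at β with VecP.≡-dec Fin._≟_ β β
  ... | yes _   = ≈-refl
  ... | no  β≢β = contradiction refl β≢β

  x^-off : ∀ {β γ} → γ ≢ β → x^ β γ ≈ 0#
  x^-off {β} {γ} γ≢β with VecP.≡-dec Fin._≟_ γ β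
  ... | yes γ≡β = contradiction γ≡β γ≢β
  ... | no  _   = ≈-refl

  x^-⋆ : ∀ β g γ → (x^ β ⋆ g) γ ≈ g (γ -ᵥ β)
  x^-⋆ β g γ = begin
    sumList (allVecs k) (λ α → x^ β α * g (γ -ᵥ α))
      ≈⟨ sumList-allVecs-δ k β (λ α α≢β → ≈-trans (*-congʳ (x^-off α≢β)) (zeroˡ _)) ⟩
    x^ β β * g (γ -ᵥ β)  ≈⟨ *-congʳ (x^-at β) ⟩
    1# * g (γ -ᵥ β)      ≈⟨ *-identityˡ _ ⟩
    g (γ -ᵥ β)           ∎
    where open ≈-Reasoning

  ρ-on : ∀ {d} s γ → coordSum γ ≡ d → ρ d s γ ≈ s γ
  ρ-on {d} s γ cs≡d with coordSum γ Fin.≟ d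
  ... | yes _    = ≈-refl
  ... | no cs≢d = contradiction cs≡d cs≢d

  ρ-off : ∀ {d} s γ → coordSum γ ≢ d → ρ d s γ ≈ 0#
  ρ-off {d} s γ cs≢d with coordSum γ Fin.≟ d
  ... | yes cs≡d = contradiction cs≡d cs≢d
  ... | no _     = ≈-refl

  infixl 6 _+ᵥ_

  _+ᵥ_ : ∀ {n} → Vec Fp n → Vec Fp n → Vec Fp n
  _+ᵥ_ = zipWith _+ₚ_

  diag : Fp → Exp
  diag j = replicate k j

  axis : Fin k → Fp → Exp
  axis i e = tabulate λ j → if does (j Fin.≟ i) then e else 0ₚ

  y^-⋆ : ∀ j g γ → (y^ (toℕ j) ⋆ g) γ ≈ g (γ -ᵥ diag j)
  y^-⋆ j g γ = ≈-trans (x^-⋆ (diag ⟦ toℕ j ⟧ₚ) g γ) (≈-reflexive (cong (λ e → g (γ -ᵥ diag e)) (ℤₚ.⟦toℕ⟧ j)))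

  +ᵥ-−ᵥ-cancel : ∀ (u w : Exp) → (u +ᵥ w) -ᵥ w ≡ u
  +ᵥ-−ᵥ-cancel = zipWith-cancel λ x y → //-rightDividesʳ y x

  −ᵥ-+ᵥ-cancel : ∀ (u w : Exp) → (u -ᵥ w) +ᵥ w ≡ u
  −ᵥ-+ᵥ-cancel = zipWith-cancel λ x y → //-rightDividesˡ y x

  −ᵥ-exchange : ∀ (u v w : Exp) → (u -ᵥ v) -ᵥ w ≡ (u -ᵥ w) -ᵥ v
  −ᵥ-exchange = zipWith-exchange λ x y z → xy∙z≈xz∙y x (-ₚ y) (-ₚ z)

  +ᵥ-−ᵥ-exchange : ∀ (u v w : Exp) → (u +ᵥ v) -ᵥ w ≡ (u -ᵥ w) +ᵥ v
  +ᵥ-−ᵥ-exchange = zipWith-exchange λ x y z → xy∙z≈xz∙y x y (-ₚ z)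

  coordSum≡sum : ∀ {n} (u : Vec Fp n) → coordSum u ≡ Σₚ.sum (lookup u)
  coordSum≡sum []      = refl
  coordSum≡sum (a ∷ u) = cong (a +ₚ_) (coordSum≡sum u)

  coordSum-+ᵥ : ∀ {n} (u v : Vec Fp n) → coordSum (u +ᵥ v) ≡ coordSum u +ₚ coordSum v
  coordSum-+ᵥ []      []      = sym (ℤₚ.+-identityˡ 0ₚ)
  coordSum-+ᵥ (a ∷ u) (b ∷ v) =
    trans (cong ((a +ₚ b) +ₚ_) (coordSum-+ᵥ u v)) (interchange a b (coordSum u) (coordSum v))

  coordSum-−ᵥ : ∀ (u v : Exp) → coordSum (u -ᵥ v) ≡ coordSum u +ₚ (-ₚ coordSum v)
  coordSum-−ᵥ u v = begin
    coordSum (u -ᵥ v)                                     ≡⟨ //-rightDividesʳ (coordSum v) _ ⟨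
    (coordSum (u -ᵥ v) +ₚ coordSum v) +ₚ (-ₚ coordSum v)  ≡⟨ cong (_+ₚ (-ₚ coordSum v)) (coordSum-+ᵥ (u -ᵥ v) v) ⟨
    coordSum ((u -ᵥ v) +ᵥ v) +ₚ (-ₚ coordSum v)           ≡⟨ cong (λ w → coordSum w +ₚ (-ₚ coordSum v)) (−ᵥ-+ᵥ-cancel u v) ⟩
    coordSum u +ₚ (-ₚ coordSum v)                         ∎
    where open ≡-Reasoning

  coordSum-replicate : ∀ n c → coordSum (replicate n c) ≡ n ×ₚ c
  coordSum-replicate zero    c = refl
  coordSum-replicate (suc n) c = cong (c +ₚ_) (coordSum-replicate n c)

  coordSum-axis : ∀ i e → coordSum (axis i e) ≡ e
  coordSum-axis i e = begin
    coordSum (tabulate f)         ≡⟨ coordSum≡sum (tabulate f) ⟩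
    Σₚ.sum (lookup (tabulate f))  ≡⟨ Σₚ.sum-cong-≗ (VecP.lookup∘tabulate f) ⟩
    Σₚ.sum f                      ≡⟨ Σₚ.sum-δ i (λ j j≢i → cong (if_then e else 0ₚ) (dec-false (j Fin.≟ i) j≢i)) ⟩
    f i                           ≡⟨ cong (if_then e else 0ₚ) (dec-true (i Fin.≟ i) refl) ⟩
    e                             ∎
    where
    open ≡-Reasoning
    f : Fin k → Fp
    f j = if does (j Fin.≟ i) then e else 0ₚ

  coordSum-permute : ∀ σ (γ : Exp) → coordSum (permute σ γ) ≡ coordSum γ
  coordSum-permute σ γ = begin
    coordSum (permute σ γ)               ≡⟨ coordSum≡sum (permute σ γ) ⟩
    Σₚ.sum (lookup (permute σ γ))        ≡⟨ Σₚ.sum-cong-≗ (lookup-permute σ γ) ⟩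
    Σₚ.sum (λ i → lookup γ (σ ⟨$⟩ˡ i))   ≡⟨ Σₚ.sum-permute (lookup γ) (flip σ) ⟨
    Σₚ.sum (lookup γ)                    ≡⟨ coordSum≡sum γ ⟨
    coordSum γ                           ∎
    where open ≡-Reasoning

  coordSum-translate : ∀ γ j → coordSum (γ -ᵥ diag j) ≡ coordSum γ +ₚ (-ₚ (k ×ₚ j))
  coordSum-translate γ j =
    trans (coordSum-−ᵥ γ (diag j)) (cong (λ x → coordSum γ +ₚ (-ₚ x)) (coordSum-replicate k j))

  coordSum-shift : ∀ δ i a → coordSum (δ -ᵥ axis i (-ₚ a)) ≡ coordSum δ +ₚ a
  coordSum-shift δ i a = begin
    coordSum (δ -ᵥ axis i (-ₚ a))                   ≡⟨ coordSum-−ᵥ δ (axis i (-ₚ a)) ⟩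
    coordSum δ +ₚ (-ₚ coordSum (axis i (-ₚ a)))     ≡⟨ cong (λ x → coordSum δ +ₚ (-ₚ x)) (coordSum-axis i (-ₚ a)) ⟩
    coordSum δ +ₚ (-ₚ (-ₚ a))                       ≡⟨ cong (coordSum δ +ₚ_) (⁻¹-involutive a) ⟩
    coordSum δ +ₚ a                                 ∎
    where open ≡-Reasoning

  level-unique : ∀ γ {j j′} → coordSum (γ -ᵥ diag j) ≡ coordSum (γ -ᵥ diag j′) → j ≡ j′
  level-unique γ {j} {j′} eq = k×-injective (⁻¹-injective (∙-cancelˡ (coordSum γ) _ _
    (trans (sym (coordSum-translate γ j)) (trans eq (coordSum-translate γ j′)))))

  IsSkew-cong : ∀ {f g} → f ≈G g → IsSkew f → IsSkew g
  IsSkew-cong f≈g (perm , diagonal) =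
    (λ γ σ → ≈-trans (≈-sym (f≈g _)) (≈-trans (perm γ σ) (*-congˡ (f≈g γ)))) ,
    (λ char2 γ i j i≢j γᵢ≡γⱼ → ≈-trans (≈-sym (f≈g γ)) (diagonal char2 γ i j i≢j γᵢ≡γⱼ))

  IsSkew-sum : ∀ {n} {f : Fin n → FG} → (∀ j → IsSkew (f j)) → IsSkew (λ γ → sum λ j → f j γ)
  IsSkew-sum {n} {f} skew =
    (λ γ σ → ≈-trans (sum-cong-≋ λ j → proj₁ (skew j) γ σ) (≈-sym (*-distribˡ-sum (sgn σ) (λ j → f j γ)))) ,
    (λ char2 γ i j i≢j γᵢ≡γⱼ → sum-zero {n} λ m → proj₂ (skew m) char2 γ i j i≢j γᵢ≡γⱼ)

  IsSkew-translate : ∀ (_⊕_ : Fp → Fp → Fp) c {f} → IsSkew f →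
                     IsSkew (λ γ → f (zipWith _⊕_ γ (diag c)))
  IsSkew-translate _⊕_ c {f} (perm , diagonal) =
    (λ γ σ → ≈-trans (≈-reflexive (cong f (permute-translate γ σ))) (perm (translate γ) σ)) ,
    (λ char2 γ i j i≢j γᵢ≡γⱼ → diagonal char2 (translate γ) i j i≢j
      (trans (lookup-translate γ i) (trans (cong (_⊕ c) γᵢ≡γⱼ) (sym (lookup-translate γ j)))))
    where
    translate : Exp → Exp
    translate γ = zipWith _⊕_ γ (diag c)
    permute-translate : ∀ γ σ → translate (permute σ γ) ≡ permute σ (translate γ)
    permute-translate γ σ = trans (cong (zipWith _⊕_ (permute σ γ)) (sym (permute-replicate σ c)))
                                  (sym (permute-zipWith _⊕_ σ γ (diag c)))
    lookup-translate : ∀ γ i → lookup (translate γ) i ≡ lookup γ i ⊕ c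
    lookup-translate γ i =
      trans (VecP.lookup-zipWith _⊕_ i γ (diag c)) (cong (lookup γ i ⊕_) (VecP.lookup-replicate i c))

  IsSkew-ρ : ∀ d {f} → IsSkew f → IsSkew (ρ d f)
  IsSkew-ρ d {f} (perm , diagonal) =
    (λ γ σ → perm′ γ σ (coordSum γ Fin.≟ d)) ,
    (λ char2 γ i j i≢j γᵢ≡γⱼ → diagonal′ char2 γ i j i≢j γᵢ≡γⱼ (coordSum γ Fin.≟ d))
    where
    open ≈-Reasoning
    perm′ : ∀ γ σ → Dec (coordSum γ ≡ d) → ρ d f (permute σ γ) ≈ sgn σ * ρ d f γ
    perm′ γ σ (yes cs≡d) = begin
      ρ d f (permute σ γ)  ≈⟨ ρ-on f (permute σ γ) (trans (coordSum-permute σ γ) cs≡d) ⟩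
      f (permute σ γ)      ≈⟨ perm γ σ ⟩
      sgn σ * f γ          ≈⟨ *-congˡ (ρ-on f γ cs≡d) ⟨
      sgn σ * ρ d f γ      ∎
    perm′ γ σ (no cs≢d) = begin
      ρ d f (permute σ γ)  ≈⟨ ρ-off f (permute σ γ) (cs≢d ∘ trans (sym (coordSum-permute σ γ))) ⟩
      0#                   ≈⟨ zeroʳ (sgn σ) ⟨
      sgn σ * 0#           ≈⟨ *-congˡ (ρ-off f γ cs≢d) ⟨
      sgn σ * ρ d f γ      ∎
    diagonal′ : CharTwo F → ∀ γ i j → i ≢ j → lookup γ i ≡ lookup γ j →
                Dec (coordSum γ ≡ d) → ρ d f γ ≈ 0#
    diagonal′ char2 γ i j i≢j γᵢ≡γⱼ (yes cs≡d) = ≈-trans (ρ-on f γ cs≡d) (diagonal char2 γ i j i≢j γᵢ≡γⱼ)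
    diagonal′ char2 γ i j i≢j γᵢ≡γⱼ (no cs≢d)  = ρ-off f γ cs≢d

  B≈sum : ∀ (t : Tensor) a q γ → B t a q γ ≈ sum λ j → ρ a (proj₁ (t j)) (γ -ᵥ diag j)
  B≈sum t a q γ = ≈-trans (≈-reflexive (sumList-allFin {p} _)) (sum-cong-≋ λ j → y^-⋆ j (ρ a (proj₁ (t j))) γ)

  B-eval : ∀ (t : Tensor) {a} (q : a ∈ A) γ j → coordSum (γ -ᵥ diag j) ≡ a →
           B t a q γ ≈ proj₁ (t j) (γ -ᵥ diag j)
  B-eval t {a} q γ j level≡a = begin
    B t a q γ                                           ≈⟨ B≈sum t a q γ ⟩
    sum (λ j′ → ρ a (proj₁ (t j′)) (γ -ᵥ diag j′))      ≈⟨ sum-δ j other-levels ⟩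
    ρ a (proj₁ (t j)) (γ -ᵥ diag j)                     ≈⟨ ρ-on (proj₁ (t j)) (γ -ᵥ diag j) level≡a ⟩
    proj₁ (t j) (γ -ᵥ diag j)                           ∎
    where
    open ≈-Reasoning
    other-levels : ∀ j′ → j′ ≢ j → ρ a (proj₁ (t j′)) (γ -ᵥ diag j′) ≈ 0#
    other-levels j′ j′≢j = ρ-off (proj₁ (t j′)) (γ -ᵥ diag j′) λ level′≡a →
      j′≢j (level-unique γ (trans level′≡a (sym level≡a)))

  B-lands-in-R : ∀ (t : Tensor) → InR (B t)
  B-lands-in-R t = InR-intro skew relation
    where
    open ≈-Reasoning
    s : Fp → FG
    s j = proj₁ (t j)
    skew : ∀ a q → IsSkew (B t a q)
    skew a q = IsSkew-cong (λ γ → ≈-sym (B≈sum t a q γ))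
                 (IsSkew-sum λ j → IsSkew-translate _ j (proj₁ (proj₁ (proj₂ (t j))) a q))
    relation-at-level : ∀ i γ j → ∑∈A (λ a _ → ρ a (s j) ((γ -ᵥ axis i (-ₚ a)) -ᵥ diag j)) ≈ 0#
    relation-at-level i γ j = begin
      ∑∈A (λ a _ → ρ a (s j) ((γ -ᵥ axis i (-ₚ a)) -ᵥ diag j))
        ≈⟨ ∑∈A-cong (λ a _ → ≈-trans (≈-reflexive (cong (ρ a (s j)) (−ᵥ-exchange γ _ (diag j))))
                                       (≈-sym (x^-⋆ _ (ρ a (s j)) (γ -ᵥ diag j)))) ⟩
      ∑∈A (λ a _ → (x[ i ]^ (-ₚ a) ⋆ ρ a (s j)) (γ -ᵥ diag j))
        ≈⟨ sumA≈∑∈A _ _ ⟨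
      sumA (λ a → x[ i ]^ (-ₚ a) ⋆ ρ a (s j)) (γ -ᵥ diag j)
        ≈⟨ proj₂ (proj₂ (t j)) i (γ -ᵥ diag j) ⟩
      0# ∎
    relation : ∀ i γ → ∑∈A (λ a q → (x[ i ]^ (-ₚ a) ⋆ B t a q) γ) ≈ 0#
    relation i γ = begin
      ∑∈A (λ a q → (x[ i ]^ (-ₚ a) ⋆ B t a q) γ)
        ≈⟨ ∑∈A-cong (λ a q → ≈-trans (x^-⋆ _ (B t a q) γ) (B≈sum t a q (γ -ᵥ axis i (-ₚ a)))) ⟩
      ∑∈A (λ a q → sum λ j → ρ a (s j) ((γ -ᵥ axis i (-ₚ a)) -ᵥ diag j))
        ≈⟨ ∑∈A-sum (λ a _ j → ρ a (s j) ((γ -ᵥ axis i (-ₚ a)) -ᵥ diag j)) ⟩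
      sum (λ j → ∑∈A λ a _ → ρ a (s j) ((γ -ᵥ axis i (-ₚ a)) -ᵥ diag j))
        ≈⟨ sum-zero (relation-at-level i γ) ⟩
      0# ∎

  B-recovers : ∀ (t : Tensor) j δ (q : coordSum δ ∈ A) →
               B t (coordSum δ) q (δ +ᵥ diag j) ≈ proj₁ (t j) δ
  B-recovers t j δ q = ≈-trans (B-eval t q (δ +ᵥ diag j) j (cong coordSum δ+j-j≡δ))
                               (≈-reflexive (cong (proj₁ (t j)) δ+j-j≡δ))
    where
    δ+j-j≡δ : (δ +ᵥ diag j) -ᵥ diag j ≡ δ
    δ+j-j≡δ = +ᵥ-−ᵥ-cancel δ (diag j)

  component-outside : ∀ (t : Tensor) j δ → ¬ coordSum δ ∈ A → proj₁ (t j) δ ≈ 0#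
  component-outside t j δ ∉A =
    ≈-trans (≈-sym (ρ-on _ δ refl)) (proj₂ (proj₁ (proj₂ (t j))) (coordSum δ) ∉A δ)

  B-injective : ∀ (t t′ : Tensor) → B t ≈T B t′ → t ≈⊗ t′
  B-injective t t′ Bt≈Bt′ j δ with coordSum δ ∈? A
  ... | yes q = ≈-trans (≈-sym (B-recovers t j δ q))
                        (≈-trans (Bt≈Bt′ (coordSum δ) q (δ +ᵥ diag j)) (B-recovers t′ j δ q))
  ... | no ∉A = ≈-trans (component-outside t j δ ∉A) (≈-sym (component-outside t′ j δ ∉A))

  module Preimage (r : Tuple) (r∈R : InR r) where

    lift : Fp → FG
    lift j δ = when (coordSum δ ∈? A) λ q → r (coordSum δ) q (δ +ᵥ diag j)

    translated : Fp → (a : Fp) → a ∈ A → FG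
    translated j a q δ = r a q (δ +ᵥ diag j)

    lift-on : ∀ {a} j δ (q : a ∈ A) → coordSum δ ≡ a → lift j δ ≈ r a q (δ +ᵥ diag j)
    lift-on j δ q refl with coordSum δ ∈? A
    ... | yes q′ = ≈-reflexive (cong (λ q → r (coordSum δ) q (δ +ᵥ diag j)) ([]=-irrelevant q′ q))
    ... | no ∉A  = contradiction q ∉A

    ρ-lift : ∀ {a} j (q : a ∈ A) → ρ a (lift j) ≈G ρ a (translated j a q)
    ρ-lift {a} j q δ with coordSum δ Fin.≟ a
    ... | yes cs≡a = lift-on j δ q cs≡a
    ... | no _     = ≈-refl

    outside : ∀ j d → ¬ d ∈ A → ρ d (lift j) ≈G 0G
    outside j d ∉A δ with coordSum δ Fin.≟ d
    ... | yes refl = when-zero (coordSum δ ∈? A) λ q → contradiction q ∉A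
    ... | no _     = ≈-refl

    relation : ∀ j i δ → sumA (λ a → x[ i ]^ (-ₚ a) ⋆ ρ a (lift j)) δ ≈ 0#
    relation j i δ = begin
      sumA (λ a → x[ i ]^ (-ₚ a) ⋆ ρ a (lift j)) δ
        ≈⟨ sumA≈∑∈A _ δ ⟩
      ∑∈A (λ a _ → (x[ i ]^ (-ₚ a) ⋆ ρ a (lift j)) δ)
        ≈⟨ ∑∈A-cong (λ a q → ≈-trans (x^-⋆ _ (ρ a (lift j)) δ) (ρ-lift j q (δ -ᵥ axis i (-ₚ a)))) ⟩
      ∑∈A (λ a q → ρ a (translated j a q) (δ -ᵥ axis i (-ₚ a)))
        ≈⟨ by-level (coordSum δ Fin.≟ 0ₚ) ⟩
      0# ∎
      where
      open ≈-Reasoning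
      shifted : ∀ a → coordSum (δ -ᵥ axis i (-ₚ a)) ≡ coordSum δ +ₚ a
      shifted = coordSum-shift δ i
      by-level : Dec (coordSum δ ≡ 0ₚ) →
                 ∑∈A (λ a q → ρ a (translated j a q) (δ -ᵥ axis i (-ₚ a))) ≈ 0#
      by-level (yes cs≡0) = ≈-trans (∑∈A-cong term) (InR-relation r∈R i (δ +ᵥ diag j))
        where
        term : ∀ a q → ρ a (translated j a q) (δ -ᵥ axis i (-ₚ a)) ≈ (x[ i ]^ (-ₚ a) ⋆ r a q) (δ +ᵥ diag j)
        term a q = begin
          ρ a (translated j a q) (δ -ᵥ axis i (-ₚ a))
            ≈⟨ ρ-on (translated j a q) (δ -ᵥ axis i (-ₚ a))
                    (trans (shifted a) (trans (cong (_+ₚ a) cs≡0) (ℤₚ.+-identityˡ a))) ⟩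
          r a q ((δ -ᵥ axis i (-ₚ a)) +ᵥ diag j)
            ≡⟨ cong (r a q) (+ᵥ-−ᵥ-exchange δ (diag j) (axis i (-ₚ a))) ⟨
          r a q ((δ +ᵥ diag j) -ᵥ axis i (-ₚ a))
            ≈⟨ x^-⋆ _ (r a q) (δ +ᵥ diag j) ⟨
          (x[ i ]^ (-ₚ a) ⋆ r a q) (δ +ᵥ diag j) ∎
      by-level (no cs≢0) = ∑∈A-zero λ a q → ρ-off _ (δ -ᵥ axis i (-ₚ a)) λ level≡a →
        cs≢0 (∙-cancelʳ a _ _ (trans (sym (shifted a)) (trans level≡a (sym (ℤₚ.+-identityˡ a)))))

    preimage : Tensor
    preimage j = lift j , ((λ a q → IsSkew-cong (λ δ → ≈-sym (ρ-lift j q δ))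
                                       (IsSkew-ρ a (IsSkew-translate _+ₚ_ j (proj₁ r∈R a q))))
                          , outside j)
                          , relation j

    B-preimage : B preimage ≈T r
    B-preimage a q γ = ≈-trans (B-eval preimage q γ j level≡a)
      (≈-trans (lift-on j (γ -ᵥ diag j) q level≡a) (≈-reflexive (cong (r a q) (−ᵥ-+ᵥ-cancel γ (diag j)))))
      where
      solution : ∃ λ j → k ×ₚ j ≡ coordSum γ +ₚ (-ₚ a)
      solution = injective⇒onto k×-injective (coordSum γ +ₚ (-ₚ a))
      j : Fp
      j = proj₁ solution
      level≡a : coordSum (γ -ᵥ diag j) ≡ a
      level≡a = begin
        coordSum (γ -ᵥ diag j)                        ≡⟨ coordSum-translate γ j ⟩
        coordSum γ +ₚ (-ₚ (k ×ₚ j))                   ≡⟨ cong (λ x → coordSum γ +ₚ (-ₚ x)) (proj₂ solution) ⟩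
        coordSum γ +ₚ (-ₚ (coordSum γ +ₚ (-ₚ a)))     ≡⟨ cong (coordSum γ +ₚ_) (⁻¹-anti-homo‿- (coordSum γ) a) ⟩
        coordSum γ +ₚ (a +ₚ (-ₚ coordSum γ))          ≡⟨ ℤₚ.+-assoc (coordSum γ) a _ ⟨
        (coordSum γ +ₚ a) +ₚ (-ₚ coordSum γ)          ≡⟨ xyx⁻¹≈y (coordSum γ) a ⟩
        a                                             ∎
        where open ≡-Reasoning

  B-isomorphism : BIsIsomorphism
  B-isomorphism = B-lands-in-R , B-injective ,
                  λ r r∈R → Preimage.preimage r r∈R , Preimage.B-preimage r r∈R

-- The bijectivity of B does not use char F ∤ p.
claim3p1 : ∀ {c ℓ} (F : Field c ℓ) (p : ℕ) {{_ : NonZero p}} → Prime p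
    → (k : ℕ) → 1 < k → k < p → (A : Subset p) → CharNotDvd F p
    → Setup.BIsIsomorphism F p k A
claim3p1 F p p-prime k 1<k k<p A _ =
  Isomorphism.B-isomorphism F p k A (Modular.×-injective p p-prime (ℕP.<-trans z<s 1<k) k<p)
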